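{- For any finite set $S$ of finite subsets of $\mathbb Z$, there is a finite set of types $(n_i,k_i,\mathbf a_i,\mathbf b_i,\mathbf c_i)_{1\le i\le k}$ such that every element of the monoid generated by $S$ under the sumset operation (i.e. every finite sumset $\mathbf s_1+\cdots+\mathbf s_m$ with $\mathbf s_j\in S$, the empty sum being $\{0\}$) belongs to $\mathcal T(n_i,k_i,\mathbf a_i,\mathbf b_i,\mathbf c_i)$ for some $1\le i\le k$.
   Context: For finite integer sets, the sumset is $\mathbf s+\mathbf t=\{a+b:a\in\mathbf s,b\in\mathbf t\}$ (so $\mathbf s+\emptyset=\emptyset$); for an integer $j\ge0$, $j\times\mathbf s$ is the $j$-fold sumset of $\mathbf s$ with itself, with $0\times\mathbf s=\{0\}$. Bottom pruning: $\mathbf s\ominus\mathbf t=\emptyset$ if $\mathbf s=\emptyset$, else $\mathbf s\setminus(\{\min\mathbf s\}+\mathbf t)$. Top pruning: $\mathbf s\ominus'\mathbf t=\emptyset$ if $\mathbf s=\emptyset$, else $\mathbf s\setminus\{\max\mathbf s-b:b\in\mathbf t\}$. For nonnegative integers $n,k$ and finite integer sets $\mathbf a,\mathbf b,\mathbf c$, the type $\mathcal T(n,k,\mathbf a,\mathbf b,\mathbf c)$ is the family $\{((j\times\{0,n\}+\mathbf b)\ominus\mathbf a)\ominus'\mathbf c+\{m\}: m\in\mathbb Z,\ j\in\mathbb Z_{\ge k}\}$. -}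

module Defs where

open import Data.Integer using (ℤ; +_; _+_; _-_; _⊓_; _⊔_)
open import Data.Integer.Properties using (_≟_)
open import Data.Nat using (ℕ; zero; suc; _≤_)
open import Data.List using (List; []; _∷_; map; concatMap; filter; foldr)
open import Data.List.Membership.Propositional using (_∈_)
open import Data.List.Membership.DecPropositional _≟_ using (_∉?_)
open import Data.Product using (Σ; ∃; _×_)
open import Function.Bundles using (_⇔_)

-- Finite sets of integers are represented by lists; two lists denote the
-- same set when they have the same members.
FinSet : Set
FinSet = List ℤ

_≐_ : FinSet → FinSet → Set
s ≐ t = ∀ x → (x ∈ s) ⇔ (x ∈ t)

_⊕_ : FinSet → FinSet → FinSet
s ⊕ t = concatMap (λ a → map (λ b → a + b) t) s

_⊗_ : ℕ → FinSet → FinSet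
zero  ⊗ s = + 0 ∷ []
suc j ⊗ s = s ⊕ (j ⊗ s)

shift : FinSet → ℤ → FinSet
shift s m = map (λ x → x + m) s

minL : ℤ → List ℤ → ℤ
minL x xs = foldr _⊓_ x xs

maxL : ℤ → List ℤ → ℤ
maxL x xs = foldr _⊔_ x xs

_⊖_ : FinSet → FinSet → FinSet
[] ⊖ t = []
(x ∷ xs) ⊖ t = filter (λ y → y ∉? map (λ b → minL x xs + b) t) (x ∷ xs)

_⊖′_ : FinSet → FinSet → FinSet
[] ⊖′ t = []
(x ∷ xs) ⊖′ t = filter (λ y → y ∉? map (λ b → maxL x xs - b) t) (x ∷ xs)

record TypeParams : Set where
  constructor mkType
  field
    n k : ℕ
    a b c : FinSet

InType : FinSet → TypeParams → Set
InType s (mkType n k a b c) =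
  Σ ℤ λ m → Σ ℕ λ j → (k ≤ j) ×
    (s ≐ shift ((((j ⊗ (+ 0 ∷ + n ∷ [])) ⊕ b) ⊖ a) ⊖′ c) m)

sumOf : List FinSet → FinSet
sumOf = foldr _⊕_ (+ 0 ∷ [])

{-# OPTIONS --safe #-}
-- Shifting each summand so that its minimum is 0 writes s₁ + ⋯ + s_m as a translate of
-- X = e₁·A₁ + ⋯ + e_r·A_r, where the Aᵢ ⊆ ℕ contain 0 and range over the finitely many
-- normalised members of S. Let D be a common multiple of the maxima of the Aᵢ. The residues
-- mod D met by e·A stop growing before e reaches D (pigeonhole), and the multiplicities beyond D
-- supply every multiple of D in the middle of X. So, away from its ends by a threshold T that
-- depends only on S, X consists exactly of the integers of [0, max X] whose residue class meets X.
-- Such a set is the grid j·{0, D} + b with b ⊆ [0, 2D), pruned by at most T points at each end: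
-- a member of one of finitely many types.
module Submission where

open import Defs
open import Algebra.Structures using (IsCommutativeMonoid)
open import Data.Empty using (⊥-elim)
open import Data.Integer as ℤ using (ℤ; +_; ∣_∣)
import Data.Integer.Properties as ℤ
import Data.Integer.Tactic.RingSolver as ℤ-Solver
open import Data.List using (List; []; _∷_; map; filter; length; upTo; foldr; cartesianProductWith; cartesianProduct; _++_)
open import Data.List.Extrema.Nat using (max; xs≤max; argmax-sel)
import Data.List.Membership.DecPropositional
open import Data.List.Membership.Propositional using (_∈_; _∉_; lose; find)
open import Data.List.Membership.Propositional.Properties
open import Data.List.Properties
  using (++-identityʳ; map-id; map-id-local; map-++; map-∘; map-cong; map-cong-local; length-map; length-filter; length-upTo;
         cartesianProductWith-zeroʳ; foldr-preservesᵒ; foldr-preservesᵇ)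
open import Data.List.Relation.Unary.All as All using (All; []; _∷_)
open import Data.List.Relation.Unary.All.Properties using (¬All⇒Any¬) renaming (map⁺ to All-map⁺; map⁻ to All-map⁻)
open import Data.List.Relation.Unary.Any as Any using (Any; here; there)
open import Data.Nat
open import Data.Nat.DivMod
open import Data.Nat.Divisibility using (_∣_; divides)
open import Data.Nat.ListAction using (sum; product)
open import Data.Nat.ListAction.Properties using (∈⇒∣product; product≢0)
open import Data.Nat.Properties
open import Data.Nat.Tactic.RingSolver using (solve-∀)
open import Algebra.Properties.CommutativeSemigroup +-commutativeSemigroup using (interchange; x∙yz≈y∙xz)
open import Data.List.Membership.DecPropositional _≟_ using (_∈?_; _∉?_)
module ℤ∈ = Data.List.Membership.DecPropositional ℤ._≟_
open import Data.Product using (∃; ∃₂; _×_; _,_; proj₁; proj₂; map₂)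
open import Data.Sum using (_⊎_; inj₁; inj₂; [_,_]′)
open import Function using (_∘_)
open import Function.Bundles using (_⇔_; mk⇔; Equivalence)
open import Relation.Binary.PropositionalEquality using (_≡_; refl; sym; trans; cong; cong₂; subst; subst₂; module ≡-Reasoning)
open import Relation.Nullary using (¬_; Dec; yes; no)
open import Relation.Nullary.Decidable using (_×-dec_)
open import Relation.Unary using (Decidable)

private variable
  A B C : Set

infix 4 _≋_
_≋_ : List A → List A → Set
s ≋ t = ∀ x → (x ∈ s) ⇔ (x ∈ t)

mk≋ : {s t : List A} → (∀ {x} → x ∈ s → x ∈ t) → (∀ {x} → x ∈ t → x ∈ s) → s ≋ t
mk≋ to from x = mk⇔ to from

≋-to : {s t : List A} → s ≋ t → ∀ {x} → x ∈ s → x ∈ t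
≋-to e {x} = Equivalence.to (e x)

≋-from : {s t : List A} → s ≋ t → ∀ {x} → x ∈ t → x ∈ s
≋-from e {x} = Equivalence.from (e x)

≋-refl : {s : List A} → s ≋ s
≋-refl = mk≋ (λ x∈ → x∈) (λ x∈ → x∈)

≋-sym : {s t : List A} → s ≋ t → t ≋ s
≋-sym e = mk≋ (≋-from e) (≋-to e)

≋-trans : {s t u : List A} → s ≋ t → t ≋ u → s ≋ u
≋-trans e f = mk≋ (≋-to f ∘ ≋-to e) (≋-from e ∘ ≋-from f)

≋-map : (f : A → B) {s t : List A} → s ≋ t → map f s ≋ map f t
≋-map f e = mk≋ (move e) (move (≋-sym e))
  where
  move : ∀ {s t} → s ≋ t → ∀ {y} → y ∈ map f s → y ∈ map f t
  move e y∈ with x , x∈ , refl ← ∈-map⁻ f y∈ = ∈-map⁺ f (≋-to e x∈)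

cartesianProductWith-map : {A′ B′ C′ : Set} {h : A → B → C} {f : A′ → A} {g : B′ → B}
  {k : C′ → C} {p : A′ → B′ → C′} → (∀ a b → h (f a) (g b) ≡ k (p a b)) →
  ∀ s t → cartesianProductWith h (map f s) (map g t) ≡ map k (cartesianProductWith p s t)
cartesianProductWith-map eq [] t = refl
cartesianProductWith-map {h = h} {f} {g} {k} {p} eq (a ∷ s) t =
  begin
    map (h (f a)) (map g t) ++ cartesianProductWith h (map f s) (map g t)
  ≡⟨ cong₂ _++_ first (cartesianProductWith-map eq s t) ⟩
    map k (map (p a) t) ++ map k (cartesianProductWith p s t)
  ≡⟨ map-++ k (map (p a) t) _ ⟨
    map k (map (p a) t ++ cartesianProductWith p s t)
  ∎
  where
  open ≡-Reasoning
  first : map (h (f a)) (map g t) ≡ map k (map (p a) t)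
  first = trans (sym (map-∘ t)) (trans (map-cong (eq a) t) (map-∘ t))

module Sumset {A : Set} {_∙_ : A → A → A} {ε : A} (isCM : IsCommutativeMonoid _≡_ _∙_ ε) where
  open IsCommutativeMonoid isCM using (assoc; comm; identityˡ; identityʳ)

  infixr 6 _⊞_
  _⊞_ : List A → List A → List A
  _⊞_ = cartesianProductWith _∙_

  _⊠_ : ℕ → List A → List A
  zero  ⊠ s = ε ∷ []
  suc j ⊠ s = s ⊞ (j ⊠ s)

  ⨁ : List (List A) → List A
  ⨁ = foldr _⊞_ (ε ∷ [])

  ∈-⊞⁺ : ∀ {s t a b} → a ∈ s → b ∈ t → a ∙ b ∈ s ⊞ t
  ∈-⊞⁺ = ∈-cartesianProductWith⁺ _∙_

  ∈-⊞⁻ : ∀ s t {x} → x ∈ s ⊞ t → ∃₂ λ a b → a ∈ s × b ∈ t × x ≡ a ∙ b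
  ∈-⊞⁻ = ∈-cartesianProductWith⁻ _∙_

  ⊞-congʳ : ∀ s {t t′} → t ≋ t′ → s ⊞ t ≋ s ⊞ t′
  ⊞-congʳ s e = mk≋ (move e) (move (≋-sym e))
    where
    move : ∀ {t t′} → t ≋ t′ → ∀ {x} → x ∈ s ⊞ t → x ∈ s ⊞ t′
    move {t} e x∈ with a , b , a∈ , b∈ , refl ← ∈-⊞⁻ s t x∈ = ∈-⊞⁺ a∈ (≋-to e b∈)

  ⊞-assoc : ∀ s t u → s ⊞ (t ⊞ u) ≋ (s ⊞ t) ⊞ u
  ⊞-assoc s t u = mk≋ to from
    where
    to : ∀ {x} → x ∈ s ⊞ (t ⊞ u) → x ∈ (s ⊞ t) ⊞ u
    to x∈ with a , y , a∈ , y∈ , refl ← ∈-⊞⁻ s (t ⊞ u) x∈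
          with b , c , b∈ , c∈ , refl ← ∈-⊞⁻ t u y∈ =
      subst (_∈ (s ⊞ t) ⊞ u) (assoc a b c) (∈-⊞⁺ (∈-⊞⁺ a∈ b∈) c∈)
    from : ∀ {x} → x ∈ (s ⊞ t) ⊞ u → x ∈ s ⊞ (t ⊞ u)
    from x∈ with y , c , y∈ , c∈ , refl ← ∈-⊞⁻ (s ⊞ t) u x∈
            with a , b , a∈ , b∈ , refl ← ∈-⊞⁻ s t y∈ =
      subst (_∈ s ⊞ (t ⊞ u)) (sym (assoc a b c)) (∈-⊞⁺ a∈ (∈-⊞⁺ b∈ c∈))

  ⊞-lcomm : ∀ s t u → s ⊞ (t ⊞ u) ≋ t ⊞ (s ⊞ u)
  ⊞-lcomm s t u = mk≋ (swap s t) (swap t s)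
    where
    swap : ∀ s t {x} → x ∈ s ⊞ (t ⊞ u) → x ∈ t ⊞ (s ⊞ u)
    swap s t x∈ with a , y , a∈ , y∈ , refl ← ∈-⊞⁻ s (t ⊞ u) x∈
                with b , c , b∈ , c∈ , refl ← ∈-⊞⁻ t u y∈ =
      subst (_∈ t ⊞ (s ⊞ u)) exchange (∈-⊞⁺ b∈ (∈-⊞⁺ a∈ c∈))
      where
      exchange : b ∙ (a ∙ c) ≡ a ∙ (b ∙ c)
      exchange = trans (sym (assoc b a c)) (trans (cong (_∙ c) (comm b a)) (assoc a b c))

  ⊞-identityˡ : ∀ s → (ε ∷ []) ⊞ s ≡ s
  ⊞-identityˡ s = trans (++-identityʳ (map (ε ∙_) s)) (trans (map-cong identityˡ s) (map-id s))

  ⨁-zero : ∀ {ss} → [] ∈ ss → ⨁ ss ≡ []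
  ⨁-zero (here refl) = refl
  ⨁-zero {s ∷ ss} (there []∈) rewrite ⨁-zero []∈ = cartesianProductWith-zeroʳ _∙_ s

  ε∈⊠ : ∀ {s} → ε ∈ s → ∀ e → ε ∈ e ⊠ s
  ε∈⊠ ε∈ zero    = here refl
  ε∈⊠ {s} ε∈ (suc e) = subst (_∈ suc e ⊠ s) (identityˡ ε) (∈-⊞⁺ ε∈ (ε∈⊠ ε∈ e))

  ∈-⊠-+ : ∀ {s} a b {x y} → x ∈ a ⊠ s → y ∈ b ⊠ s → x ∙ y ∈ (a + b) ⊠ s
  ∈-⊠-+ zero b (here refl) y∈ = subst (_∈ b ⊠ _) (sym (identityˡ _)) y∈
  ∈-⊠-+ {s} (suc a) b {y = y} x∈ y∈ with u , v , u∈ , v∈ , refl ← ∈-⊞⁻ s (a ⊠ s) x∈ =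
    subst (_∈ (suc a + b) ⊠ s) (sym (assoc u v y)) (∈-⊞⁺ u∈ (∈-⊠-+ a b v∈ y∈))

  ∈-⊠-mono : ∀ {s a b x} → ε ∈ s → a ≤ b → x ∈ a ⊠ s → x ∈ b ⊠ s
  ∈-⊠-mono {s} {a} {b} {x} ε∈ a≤b x∈ =
    subst₂ (λ y e → y ∈ e ⊠ s) (identityʳ x) (m+[n∸m]≡n a≤b) (∈-⊠-+ a (b ∸ a) x∈ (ε∈⊠ ε∈ (b ∸ a)))

open Sumset +-0-isCommutativeMonoid
module ℤˢ = Sumset ℤ.+-0-isCommutativeMonoid

toℤ : List ℕ → FinSet
toℤ = map (+_)

⊕≡⊞ : ∀ s t → s ⊕ t ≡ s ℤˢ.⊞ t
⊕≡⊞ []      t = refl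
⊕≡⊞ (a ∷ s) t = cong (map (λ b → a ℤ.+ b) t ++_) (⊕≡⊞ s t)

⊗≡⊠ : ∀ j s → j ⊗ s ≡ j ℤˢ.⊠ s
⊗≡⊠ zero    s = refl
⊗≡⊠ (suc j) s = trans (⊕≡⊞ s (j ⊗ s)) (cong (s ℤˢ.⊞_) (⊗≡⊠ j s))

toℤ-⊞ : ∀ s t → toℤ (s ⊞ t) ≡ toℤ s ℤˢ.⊞ toℤ t
toℤ-⊞ s t = sym (cartesianProductWith-map (λ _ _ → refl) s t)

toℤ-⊠ : ∀ j s → toℤ (j ⊠ s) ≡ j ℤˢ.⊠ toℤ s
toℤ-⊠ zero    s = refl
toℤ-⊠ (suc j) s = trans (toℤ-⊞ s (j ⊠ s)) (cong (toℤ s ℤˢ.⊞_) (toℤ-⊠ j s))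

-- Normal form of a sum of finite sets of integers

minL-≤ : ∀ x xs {y} → y ∈ x ∷ xs → minL x xs ℤ.≤ y
minL-≤ x xs {y} y∈ = foldr-preservesᵒ glb x xs (member y∈)
  where
  glb : ∀ a b → a ℤ.≤ y ⊎ b ℤ.≤ y → a ℤ.⊓ b ℤ.≤ y
  glb a b (inj₁ a≤y) = ℤ.i≤j⇒i⊓k≤j b a≤y
  glb a b (inj₂ b≤y) = ℤ.i≤j⇒k⊓i≤j a b≤y
  member : y ∈ x ∷ xs → x ℤ.≤ y ⊎ Any (ℤ._≤ y) xs
  member (here refl) = inj₁ ℤ.≤-refl
  member (there y∈)  = inj₂ (Any.map (λ { refl → ℤ.≤-refl }) y∈)

minL-∈ : ∀ x xs → minL x xs ∈ x ∷ xs
minL-∈ x xs with foldr-selective ℤ.⊓-sel x xs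
... | inj₁ ≡x = here ≡x
... | inj₂ ∈xs = there ∈xs

≤-maxL : ∀ x xs {y} → y ∈ x ∷ xs → y ℤ.≤ maxL x xs
≤-maxL x xs {y} y∈ = foldr-preservesᵒ lub x xs (member y∈)
  where
  lub : ∀ a b → y ℤ.≤ a ⊎ y ℤ.≤ b → y ℤ.≤ a ℤ.⊔ b
  lub a b (inj₁ y≤a) = ℤ.i≤j⇒i≤j⊔k b y≤a
  lub a b (inj₂ y≤b) = ℤ.i≤j⇒i≤k⊔j a y≤b
  member : y ∈ x ∷ xs → y ℤ.≤ x ⊎ Any (y ℤ.≤_) xs
  member (here refl) = inj₁ ℤ.≤-refl
  member (there y∈)  = inj₂ (Any.map (λ { refl → ℤ.≤-refl }) y∈)

maxL-≤ : ∀ {x xs M} → All (ℤ._≤ M) (x ∷ xs) → maxL x xs ℤ.≤ M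
maxL-≤ (x≤M ∷ xs≤M) = foldr-preservesᵇ ℤ.⊔-lub x≤M xs≤M

lowest : FinSet → ℤ
lowest []       = + 0
lowest (x ∷ xs) = minL x xs

normalize : FinSet → List ℕ
normalize s = map (λ y → ∣ y ℤ.- lowest s ∣) s

embedAt : ℤ → List ℕ → FinSet
embedAt m A = map (λ n → + n ℤ.+ m) A

embedAt≡shift : ∀ m A → embedAt m A ≡ shift (toℤ A) m
embedAt≡shift m A = map-∘ A

normalize-embedAt : ∀ s → embedAt (lowest s) (normalize s) ≡ s
normalize-embedAt []         = refl
normalize-embedAt s@(x ∷ xs) = trans (sym (map-∘ s)) (map-id-local (All.tabulate restore))
  where
  restore : ∀ {y} → y ∈ s → + ∣ y ℤ.- minL x xs ∣ ℤ.+ minL x xs ≡ y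
  restore {y} y∈ = begin
    + ∣ y ℤ.- m ∣ ℤ.+ m ≡⟨ cong (ℤ._+ m) (ℤ.0≤i⇒+∣i∣≡i (ℤ.i≤j⇒0≤j-i (minL-≤ x xs y∈))) ⟩
    (y ℤ.- m) ℤ.+ m     ≡⟨ cancel y m ⟩
    y                   ∎
    where
    open ≡-Reasoning
    m : ℤ
    m = minL x xs
    cancel : ∀ y m → (y ℤ.- m) ℤ.+ m ≡ y
    cancel = ℤ-Solver.solve-∀

0∈normalize : ∀ x xs → 0 ∈ normalize (x ∷ xs)
0∈normalize x xs = subst (_∈ normalize (x ∷ xs)) (cong ∣_∣ (ℤ.+-inverseʳ (minL x xs)))
  (∈-map⁺ (λ y → ∣ y ℤ.- minL x xs ∣) (minL-∈ x xs))

offset : List FinSet → ℤ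
offset = foldr (λ s m → lowest s ℤ.+ m) (+ 0)

sumOf-embedAt : ∀ ss → sumOf ss ≡ embedAt (offset ss) (⨁ (map normalize ss))
sumOf-embedAt []       = refl
sumOf-embedAt (s ∷ ss) = begin
  s ⊕ sumOf ss
    ≡⟨ ⊕≡⊞ s (sumOf ss) ⟩
  s ℤˢ.⊞ sumOf ss
    ≡⟨ cong₂ ℤˢ._⊞_ (sym (normalize-embedAt s)) (sumOf-embedAt ss) ⟩
  embedAt (lowest s) (normalize s) ℤˢ.⊞ embedAt (offset ss) (⨁ (map normalize ss))
    ≡⟨ cartesianProductWith-map (λ a b → regroup (+ a) (+ b) (lowest s) (offset ss)) (normalize s) (⨁ (map normalize ss)) ⟩
  embedAt (offset (s ∷ ss)) (normalize s ⊞ ⨁ (map normalize ss))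
    ∎
  where
  open ≡-Reasoning
  regroup : ∀ a b l m → (a ℤ.+ l) ℤ.+ (b ℤ.+ m) ≡ (a ℤ.+ b) ℤ.+ (l ℤ.+ m)
  regroup = ℤ-Solver.solve-∀

∈-⊖ : ∀ {s m} t → m ∈ s → All (m ℤ.≤_) s → ∀ {y} → y ∈ s ⊖ t ⇔ (y ∈ s × y ∉ map (λ b → m ℤ.+ b) t)
∈-⊖ {x ∷ xs} {m} t m∈ m≤ rewrite ℤ.≤-antisym (minL-≤ x xs m∈) (All.lookup m≤ (minL-∈ x xs)) =
  mk⇔ (∈-filter⁻ survives) λ (y∈ , y∉) → ∈-filter⁺ survives y∈ y∉
  where
  survives : Decidable (λ y → y ∉ map (λ b → m ℤ.+ b) t)
  survives y = y ℤ∈.∉? map (λ b → m ℤ.+ b) t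

∈-⊖′ : ∀ {s M} t → M ∈ s → All (ℤ._≤ M) s → ∀ {y} → y ∈ s ⊖′ t ⇔ (y ∈ s × y ∉ map (λ b → M ℤ.- b) t)
∈-⊖′ {x ∷ xs} {M} t M∈ ≤M rewrite ℤ.≤-antisym (maxL-≤ ≤M) (≤-maxL x xs M∈) =
  mk⇔ (∈-filter⁻ survives) λ (y∈ , y∉) → ∈-filter⁺ survives y∈ y∉
  where
  survives : Decidable (λ y → y ∉ map (λ b → M ℤ.- b) t)
  survives y = y ℤ∈.∉? map (λ b → M ℤ.- b) t

∈-toℤ⁺ : ∀ {n A} → n ∈ A → + n ∈ toℤ A
∈-toℤ⁺ = ∈-map⁺ (+_)

∈-toℤ⁻ : ∀ {n A} → + n ∈ toℤ A → n ∈ A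
∈-toℤ⁻ {A = A} n∈ with m , m∈ , eq ← ∈-map⁻ (+_) n∈ = subst (_∈ A) (sym (ℤ.+-injective eq)) m∈

embedded-pruning : ∀ {F A C L} → 0 ∈ F → L ∈ F → All (_≤ L) F → L ∉ A → All (_≤ L) C →
  (toℤ F ⊖ toℤ A) ⊖′ toℤ C ≋
  toℤ (filter (λ n → (n ∉? A) ×-dec (n ∉? map (L ∸_) C)) F)
embedded-pruning {F} {A} {C} {L} 0∈F L∈F F≤L L∉A C≤L = mk≋ to from
  where
  G : FinSet
  G = toℤ F ⊖ toℤ A

  survives : Decidable (λ n → n ∉ A × n ∉ map (L ∸_) C)
  survives n = (n ∉? A) ×-dec (n ∉? map (L ∸_) C)

  translateBy0 : map (λ b → + 0 ℤ.+ b) (toℤ A) ≡ toℤ A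
  translateBy0 = sym (map-∘ A)

  reflectAtL : map (λ b → + L ℤ.- b) (toℤ C) ≡ toℤ (map (L ∸_) C)
  reflectAtL = trans (sym (map-∘ C))
    (trans (map-cong-local (All.map (λ {t} t≤L → trans (ℤ.m-n≡m⊖n L t) (ℤ.⊖-≥ t≤L)) C≤L)) (map-∘ C))

  bottom : ∀ {y} → y ∈ G ⇔ (y ∈ toℤ F × y ∉ toℤ A)
  bottom {y} = subst (λ R → y ∈ G ⇔ (y ∈ toℤ F × y ∉ R)) translateBy0
    (∈-⊖ (toℤ A) (∈-toℤ⁺ 0∈F) (All.tabulate λ y∈ → nonneg (∈-map⁻ (+_) y∈)))
    where
    nonneg : ∀ {y} → ∃ (λ n → n ∈ F × y ≡ + n) → + 0 ℤ.≤ y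
    nonneg (n , _ , refl) = ℤ.+≤+ z≤n

  belowL : ∀ {y} → y ∈ toℤ F → y ℤ.≤ + L
  belowL y∈ with n , n∈ , refl ← ∈-map⁻ (+_) y∈ = ℤ.+≤+ (All.lookup F≤L n∈)

  top : ∀ {y} → y ∈ G ⊖′ toℤ C ⇔ (y ∈ G × y ∉ toℤ (map (L ∸_) C))
  top {y} = subst (λ R → y ∈ G ⊖′ toℤ C ⇔ (y ∈ G × y ∉ R)) reflectAtL
    (∈-⊖′ (toℤ C) (Equivalence.from bottom (∈-toℤ⁺ L∈F , L∉A ∘ ∈-toℤ⁻))
      (All.tabulate (belowL ∘ proj₁ ∘ Equivalence.to bottom)))

  to : ∀ {y} → y ∈ G ⊖′ toℤ C → y ∈ toℤ (filter survives F)
  to y∈ with y∈G , y∉C ← Equivalence.to top y∈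
         with y∈F , y∉A ← Equivalence.to bottom y∈G
         with n , n∈F , refl ← ∈-map⁻ (+_) y∈F =
    ∈-toℤ⁺ (∈-filter⁺ survives n∈F (y∉A ∘ ∈-toℤ⁺ , y∉C ∘ ∈-toℤ⁺))

  from : ∀ {y} → y ∈ toℤ (filter survives F) → y ∈ G ⊖′ toℤ C
  from y∈ with n , n∈ , refl ← ∈-map⁻ (+_) y∈
           with n∈F , n∉A , n∉C ← ∈-filter⁻ survives n∈ =
    Equivalence.from top (Equivalence.from bottom (∈-toℤ⁺ n∈F , n∉A ∘ ∈-toℤ⁻) , n∉C ∘ ∈-toℤ⁻)

-- Weighted sums of finite sets of naturals

max∈ : ∀ {s} → 0 ∈ s → max 0 s ∈ s
max∈ {s} 0∈ with argmax-sel (λ x → x) 0 s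
... | inj₁ ≡0 = subst (_∈ s) (sym ≡0) 0∈
... | inj₂ ∈s = ∈s

*∈⊠ : ∀ {s d} → d ∈ s → ∀ p → p * d ∈ p ⊠ s
*∈⊠ d∈ zero    = here refl
*∈⊠ d∈ (suc p) = ∈-⊞⁺ d∈ (*∈⊠ d∈ p)

⊠-bounded : ∀ {s d} → All (_≤ d) s → ∀ e {x} → x ∈ e ⊠ s → x ≤ e * d
⊠-bounded s≤d zero    (here refl) = z≤n
⊠-bounded {s} s≤d (suc e) x∈ with u , v , u∈ , v∈ , refl ← ∈-⊞⁻ s (e ⊠ s) x∈ =
  +-mono-≤ (All.lookup s≤d u∈) (⊠-bounded s≤d e v∈)

Weighted : Set
Weighted = List (List ℕ × ℕ)

combination : Weighted → List ℕ
combination []             = 0 ∷ []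
combination ((s , e) ∷ ps) = e ⊠ s ⊞ combination ps

height : Weighted → ℕ
height []             = 0
height ((s , e) ∷ ps) = e * max 0 s + height ps

reweigh : (ℕ → ℕ) → Weighted → Weighted
reweigh f = map (map₂ f)

Pointed : Weighted → Set
Pointed = All ((0 ∈_) ∘ proj₁)

0∈combination : ∀ {ps} → Pointed ps → 0 ∈ combination ps
0∈combination []                       = here refl
0∈combination {(s , e) ∷ _} (0∈ ∷ pts) = ∈-⊞⁺ (ε∈⊠ 0∈ e) (0∈combination pts)

height∈combination : ∀ {ps} → Pointed ps → height ps ∈ combination ps
height∈combination []                       = here refl
height∈combination {(s , e) ∷ _} (0∈ ∷ pts) = ∈-⊞⁺ (*∈⊠ (max∈ 0∈) e) (height∈combination pts)

combination≤height : ∀ ps {x} → x ∈ combination ps → x ≤ height ps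
combination≤height []             (here refl) = z≤n
combination≤height ((s , e) ∷ ps) x∈ with u , v , u∈ , v∈ , refl ← ∈-⊞⁻ (e ⊠ s) (combination ps) x∈ =
  +-mono-≤ (⊠-bounded (xs≤max 0 s) e u∈) (combination≤height ps v∈)

combination-split : ∀ {f g} → (∀ e → f e + g e ≡ e) → ∀ ps {x y} →
  x ∈ combination (reweigh f ps) → y ∈ combination (reweigh g ps) → x + y ∈ combination ps
combination-split f+g []             (here refl) (here refl) = here refl
combination-split {f} {g} f+g ((s , e) ∷ ps) x∈ y∈
  with u , v , u∈ , v∈ , refl ← ∈-⊞⁻ (f e ⊠ s) (combination (reweigh f ps)) x∈
     | u′ , v′ , u′∈ , v′∈ , refl ← ∈-⊞⁻ (g e ⊠ s) (combination (reweigh g ps)) y∈ =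
  subst (_∈ combination ((s , e) ∷ ps)) (interchange u u′ v v′)
    (∈-⊞⁺ (subst (λ k → u + u′ ∈ k ⊠ s) (f+g e) (∈-⊠-+ (f e) (g e) u∈ u′∈)) (combination-split f+g ps v∈ v′∈))

height-split : ∀ {f g} → (∀ e → f e + g e ≡ e) → ∀ ps →
  height ps ≡ height (reweigh f ps) + height (reweigh g ps)
height-split f+g []                   = refl
height-split {f} {g} f+g ((s , e) ∷ ps) = begin
  e * d + height ps
    ≡⟨ cong₂ _+_ (cong (_* d) (sym (f+g e))) (height-split f+g ps) ⟩
  (f e + g e) * d + (hf + hg)
    ≡⟨ cong (_+ (hf + hg)) (*-distribʳ-+ d (f e) (g e)) ⟩
  (f e * d + g e * d) + (hf + hg)
    ≡⟨ interchange (f e * d) (g e * d) hf hg ⟩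
  (f e * d + hf) + (g e * d + hg)
    ∎
  where
  open ≡-Reasoning
  d hf hg : ℕ
  d = max 0 s
  hf = height (reweigh f ps)
  hg = height (reweigh g ps)

spread : List (List ℕ) → ℕ
spread S = sum (map (max 0) S)

height-reweigh≤ : ∀ {f K} → (∀ e → f e ≤ K) → ∀ ps → height (reweigh f ps) ≤ K * spread (map proj₁ ps)
height-reweigh≤ f≤K []                       = z≤n
height-reweigh≤ {f} {K} f≤K ((s , e) ∷ ps) =
  subst (f e * max 0 s + height (reweigh f ps) ≤_) (sym (*-distribˡ-+ K (max 0 s) (spread (map proj₁ ps))))
    (+-mono-≤ (*-monoˡ-≤ (max 0 s) (f≤K e)) (height-reweigh≤ f≤K ps))

combination-unweighted : ∀ S → combination (map (_, 0) S) ≡ 0 ∷ []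
combination-unweighted []      = refl
combination-unweighted (s ∷ S) = trans (⊞-identityˡ _) (combination-unweighted S)

⊞-combination : ∀ {s} ps → s ∈ map proj₁ ps →
  ∃ λ ps′ → map proj₁ ps′ ≡ map proj₁ ps × s ⊞ combination ps ≋ combination ps′
⊞-combination ((t , e) ∷ ps) (here refl) =
  (t , suc e) ∷ ps , refl , ⊞-assoc t (e ⊠ t) (combination ps)
⊞-combination {s} ((t , e) ∷ ps) (there s∈) with ps′ , same , s⊞≋ ← ⊞-combination ps s∈ =
  (t , e) ∷ ps′ , cong (t ∷_) same ,
  ≋-trans (⊞-lcomm s (e ⊠ t) (combination ps)) (⊞-congʳ (e ⊠ t) s⊞≋)

⨁≋combination : ∀ S ss → All (_∈ S) ss → ∃ λ ps → map proj₁ ps ≡ S × ⨁ ss ≋ combination ps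
⨁≋combination S [] [] =
  map (_, 0) S , trans (sym (map-∘ S)) (map-id S) , subst (0 ∷ [] ≋_) (sym (combination-unweighted S)) ≋-refl
⨁≋combination S (s ∷ ss) (s∈ ∷ ss⊆S) with ps , sets≡ , ⨁≋ ← ⨁≋combination S ss ss⊆S
    with ps′ , same , s⊞≋ ← ⊞-combination ps (subst (s ∈_) (sym sets≡) s∈) =
  ps′ , trans same sets≡ , ≋-trans (⊞-congʳ s ⨁≋) s⊞≋

-- Residues modulo D

module _ {P Q : A → Set} (P? : Decidable P) (Q? : Decidable Q) (P⇒Q : ∀ {x} → P x → Q x) where

  filter-length-mono : ∀ xs → length (filter P? xs) ≤ length (filter Q? xs)
  filter-length-mono []       = z≤n
  filter-length-mono (x ∷ xs) with P? x | Q? x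
  ... | yes _ | yes _ = s≤s (filter-length-mono xs)
  ... | yes p | no ¬q = ⊥-elim (¬q (P⇒Q p))
  ... | no _  | yes _ = m≤n⇒m≤1+n (filter-length-mono xs)
  ... | no _  | no _  = filter-length-mono xs

  filter-length-< : ∀ xs {r} → r ∈ xs → Q r → ¬ P r → length (filter P? xs) < length (filter Q? xs)
  filter-length-< (x ∷ xs) (here refl) q ¬p with P? x | Q? x
  ... | yes p | _     = ⊥-elim (¬p p)
  ... | no _  | yes _ = s≤s (filter-length-mono xs)
  ... | no _  | no ¬q = ⊥-elim (¬q q)
  filter-length-< (x ∷ xs) (there r∈) q ¬p with P? x | Q? x
  ... | yes _ | yes _ = s≤s (filter-length-< xs r∈ q ¬p)
  ... | yes p | no ¬q = ⊥-elim (¬q (P⇒Q p))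
  ... | no _  | yes _ = m≤n⇒m≤1+n (filter-length-< xs r∈ q ¬p)
  ... | no _  | no _  = filter-length-< xs r∈ q ¬p

module Modulo (D : ℕ) .{{_ : NonZero D}} where

  infix 4 _∈%_ _∈%?_ _⊆%_

  _∈%_ : ℕ → List ℕ → Set
  x ∈% X = Any (λ z → z % D ≡ x % D) X

  _∈%?_ : ∀ x X → Dec (x ∈% X)
  x ∈%? X = Any.any? (λ z → z % D ≟ x % D) X

  _⊆%_ : List ℕ → List ℕ → Set
  X ⊆% Y = ∀ {x} → x ∈ X → x ∈% Y

  ∈⇒∈% : ∀ {x X} → x ∈ X → x ∈% X
  ∈⇒∈% x∈ = lose x∈ refl

  ∈%-trans : ∀ {x X Y} → x ∈% X → X ⊆% Y → x ∈% Y
  ∈%-trans x∈%X X⊆%Y with z , z∈ , z≡x ← find x∈%X = Any.map (λ w≡z → trans w≡z z≡x) (X⊆%Y z∈)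

  %-cong-+ : ∀ {a a′ b b′} → a % D ≡ a′ % D → b % D ≡ b′ % D → (a + b) % D ≡ (a′ + b′) % D
  %-cong-+ {a} {a′} {b} {b′} a≡a′ b≡b′ = begin
    (a + b) % D           ≡⟨ %-distribˡ-+ a b D ⟩
    (a % D + b % D) % D   ≡⟨ cong₂ (λ u v → (u + v) % D) a≡a′ b≡b′ ⟩
    (a′ % D + b′ % D) % D ≡⟨ %-distribˡ-+ a′ b′ D ⟨
    (a′ + b′) % D         ∎
    where open ≡-Reasoning

  ⊆%-or-escape : ∀ X Y → X ⊆% Y ⊎ ∃ λ x → x ∈ X × ¬ x ∈% Y
  ⊆%-or-escape X Y with All.all? (_∈%? Y) X
  ... | yes all = inj₁ (All.lookup all)
  ... | no ¬all = inj₂ (find (¬All⇒Any¬ (_∈%? Y) X ¬all))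

  residueCount : List ℕ → ℕ
  residueCount X = length (filter (_∈%? X) (upTo D))

  residueCount≤ : ∀ X → residueCount X ≤ D
  residueCount≤ X = subst (residueCount X ≤_) (length-upTo D) (length-filter (_∈%? X) (upTo D))

  residueCount-< : ∀ {X Y x} → X ⊆% Y → x ∈ Y → ¬ x ∈% X → residueCount X < residueCount Y
  residueCount-< {X} {Y} {x} X⊆%Y x∈Y x∉%X =
    filter-length-< (_∈%? X) (_∈%? Y) (λ r∈%X → ∈%-trans r∈%X X⊆%Y) (upTo D)
      (∈-upTo⁺ (m%n<n x D)) (lose x∈Y (sym (m%n%n≡m%n x D)))
      (λ r∈%X → x∉%X (Any.map (λ z≡r → trans z≡r (m%n%n≡m%n x D)) r∈%X))

  stagnation-or-growth : (E : ℕ → List ℕ) → (∀ e → E e ⊆% E (suc e)) →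
    ∀ n → (∃ λ e → e < n × E (suc e) ⊆% E e) ⊎ n ≤ residueCount (E n)
  stagnation-or-growth E grows zero    = inj₂ z≤n
  stagnation-or-growth E grows (suc n) with stagnation-or-growth E grows n
  ... | inj₁ (e , e<n , stuck) = inj₁ (e , m<n⇒m<1+n e<n , stuck)
  ... | inj₂ n≤count with ⊆%-or-escape (E (suc n)) (E n)
  ...   | inj₁ stuck          = inj₁ (n , n<1+n n , stuck)
  ...   | inj₂ (x , x∈ , x∉%) = inj₂ (≤-trans (s≤s n≤count) (residueCount-< (grows n) x∈ x∉%))

  -- A step that is not stuck meets a new residue class, and there are only D of them.
  stagnation : (E : ℕ → List ℕ) → (∀ e → E e ⊆% E (suc e)) → ∃ λ e → e ≤ D × E (suc e) ⊆% E e
  stagnation E grows with stagnation-or-growth E grows (suc D)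
  ... | inj₁ (e , e<1+D , stuck) = e , ≤-pred e<1+D , stuck
  ... | inj₂ 1+D≤count = ⊥-elim (<⇒≱ (s≤s (residueCount≤ (E (suc D)))) 1+D≤count)

  ⊠-stuck : ∀ {s e} → suc e ⊠ s ⊆% e ⊠ s → ∀ k → (k + e) ⊠ s ⊆% e ⊠ s
  ⊠-stuck stuck zero    x∈ = ∈⇒∈% x∈
  ⊠-stuck {s} {e} stuck (suc k) x∈ with a , x′ , a∈ , x′∈ , refl ← ∈-⊞⁻ s ((k + e) ⊠ s) x∈
                                  with z′ , z′∈ , z′≡x′ ← find (⊠-stuck stuck k x′∈) =
    Any.map (λ z≡az′ → trans z≡az′ (%-cong-+ {a} refl z′≡x′)) (stuck (∈-⊞⁺ a∈ z′∈))

  ⊠-residues : ∀ {s} → 0 ∈ s → ∀ e → e ⊠ s ⊆% (D ⊓ e) ⊠ s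
  ⊠-residues {s} 0∈ e x∈ with e ≤? D
  ... | yes e≤D = subst (λ k → _ ∈% k ⊠ s) (sym (m≥n⇒m⊓n≡n e≤D)) (∈⇒∈% x∈)
  ... | no  e≰D with e₀ , e₀≤D , stuck ← stagnation (_⊠ s) (λ e → ∈⇒∈% ∘ ∈-⊠-mono 0∈ (n≤1+n e)) =
    subst (λ k → _ ∈% k ⊠ s) (sym (m≤n⇒m⊓n≡m D≤e))
      (∈%-trans (⊠-stuck stuck (e ∸ e₀) (subst (λ k → _ ∈ k ⊠ s) (sym (m∸n+n≡m e₀≤e)) x∈))
        (∈⇒∈% ∘ ∈-⊠-mono 0∈ e₀≤D))
    where
    D≤e : D ≤ e
    D≤e = <⇒≤ (≰⇒> e≰D)
    e₀≤e : e₀ ≤ e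
    e₀≤e = ≤-trans e₀≤D D≤e

  combination-residues : ∀ {ps} → Pointed ps → combination ps ⊆% combination (reweigh (D ⊓_) ps)
  combination-residues {[]} [] x∈ = ∈⇒∈% x∈
  combination-residues {(s , e) ∷ ps} (0∈ ∷ pts) x∈
    with u , v , u∈ , v∈ , refl ← ∈-⊞⁻ (e ⊠ s) (combination ps) x∈
    with a , a∈ , a≡u ← find (⊠-residues 0∈ e u∈)
       | b , b∈ , b≡v ← find (combination-residues pts v∈) =
    lose (∈-⊞⁺ a∈ b∈) (%-cong-+ a≡u b≡v)

  Multiples : ℕ → List ℕ → ℕ → Set
  Multiples gap A top = ∀ p → p * D + gap ≤ top → p * D ∈ A

  multiples-⊠ : ∀ {s} f → 0 ∈ s → max 0 s ≡ 0 ⊎ max 0 s ∣ D → Multiples 0 (f ⊠ s) (f * max 0 s)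
  multiples-⊠ {s} f 0∈ d∣D p bound with max 0 s in max≡
  ... | zero = subst (_∈ f ⊠ s) (sym p*D≡0) (ε∈⊠ 0∈ f)
    where
    p*D≡0 : p * D ≡ 0
    p*D≡0 = n≤0⇒n≡0 (≤-trans (m≤m+n (p * D) 0) (subst (p * D + 0 ≤_) (*-zeroʳ f) bound))
  ... | suc d with d∣D
  ...   | inj₂ (divides m D≡m*d) = subst (_∈ f ⊠ s) (sym p*D≡) (∈-⊠-mono 0∈ pm≤f (*∈⊠ d∈ (p * m)))
    where
    p*D≡ : p * D ≡ p * m * suc d
    p*D≡ = trans (cong (p *_) D≡m*d) (sym (*-assoc p m (suc d)))
    d∈ : suc d ∈ s
    d∈ = subst (_∈ s) max≡ (max∈ 0∈)
    pm≤f : p * m ≤ f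
    pm≤f = *-cancelʳ-≤ (p * m) f (suc d) (subst (_≤ f * suc d) p*D≡ (≤-trans (m≤m+n (p * D) 0) bound))

  multiples-⊞ : ∀ {A B α β g} → Multiples 0 A α → Multiples g B β → 0 ∈ B →
    Multiples (D + g) (A ⊞ B) (α + β)
  multiples-⊞ {A} {B} {α} {β} {g} mA mB 0∈B p bound with p ≤? α / D
  ... | yes p≤q = subst (_∈ A ⊞ B) (+-identityʳ (p * D)) (∈-⊞⁺ (mA p p*D≤α) 0∈B)
    where
    p*D≤α : p * D + 0 ≤ α
    p*D≤α = subst (_≤ α) (sym (+-identityʳ (p * D))) (≤-trans (*-monoˡ-≤ D p≤q) (m/n*n≤m α D))
  ... | no  p≰q = subst (_∈ A ⊞ B) q+r≡p (∈-⊞⁺ (mA q q*D≤α) (mB r r-bound))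
    where
    q r : ℕ
    q = α / D
    r = p ∸ q
    q+r≡p : q * D + r * D ≡ p * D
    q+r≡p = trans (sym (*-distribʳ-+ D q r)) (cong (_* D) (m+[n∸m]≡n (<⇒≤ (≰⇒> p≰q))))
    q*D≤α : q * D + 0 ≤ α
    q*D≤α = subst (_≤ α) (sym (+-identityʳ (q * D))) (m/n*n≤m α D)
    α≤ : α ≤ D + q * D
    α≤ = subst (_≤ D + q * D) (sym (m≡m%n+[m/n]*n α D)) (+-monoˡ-≤ (q * D) (<⇒≤ (m%n<n α D)))
    r-bound : r * D + g ≤ β
    r-bound = +-cancelˡ-≤ (D + q * D) _ _ (begin
      (D + q * D) + (r * D + g)   ≡⟨ rearrange D (q * D) (r * D) g ⟩
      (q * D + r * D) + (D + g)   ≡⟨ cong (_+ (D + g)) q+r≡p ⟩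
      p * D + (D + g)             ≤⟨ bound ⟩
      α + β                       ≤⟨ +-monoˡ-≤ β α≤ ⟩
      (D + q * D) + β             ∎)
      where
      open ≤-Reasoning
      rearrange : ∀ a b c d → (a + b) + (c + d) ≡ (b + c) + (a + d)
      rearrange = solve-∀

  -- A zero maximum is allowed separately, as `0 ∣ D` fails for D ≠ 0.
  Dividing : Weighted → Set
  Dividing = All (λ p → max 0 (proj₁ p) ≡ 0 ⊎ max 0 (proj₁ p) ∣ D)

  multiples-combination : ∀ {ps} → Pointed ps → Dividing ps →
    Multiples (length ps * D) (combination ps) (height ps)
  multiples-combination [] [] p bound =
    subst (_∈ 0 ∷ []) (sym (n≤0⇒n≡0 (≤-trans (m≤m+n (p * D) 0) bound))) (here refl)
  multiples-combination {(s , f) ∷ ps} (0∈ ∷ pts) (d∣D ∷ dvs) =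
    multiples-⊞ (multiples-⊠ f 0∈ d∣D) (multiples-combination pts dvs) (0∈combination pts)

  residue-gap : ∀ {z y} → z ≤ y → z % D ≡ y % D → ∃ λ q → y ≡ z + q * D
  residue-gap {z} {y} z≤y z≡y = q , (begin
    y                          ≡⟨ m≡m%n+[m/n]*n y D ⟩
    y % D + y / D * D          ≡⟨ cong₂ (λ u v → u + v * D) (sym z≡y) (sym (m+[n∸m]≡n z/D≤y/D)) ⟩
    z % D + (z / D + q) * D    ≡⟨ cong (λ w → z % D + w) (*-distribʳ-+ D (z / D) q) ⟩
    z % D + (z / D * D + q * D) ≡⟨ +-assoc (z % D) _ _ ⟨
    (z % D + z / D * D) + q * D ≡⟨ cong (_+ q * D) (m≡m%n+[m/n]*n z D) ⟨
    z + q * D                  ∎)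
    where
    open ≡-Reasoning
    z/D≤y/D : z / D ≤ y / D
    z/D≤y/D = /-monoˡ-≤ D z≤y
    q : ℕ
    q = y / D ∸ z / D

  threshold : List (List ℕ) → ℕ
  threshold S = D * spread S + length S * D

  -- y exceeds its capped representative z by a multiple of D, which the excess weights supply.
  lift-representative : ∀ {ps y z} → Pointed ps → Dividing ps →
    threshold (map proj₁ ps) ≤ y → y + threshold (map proj₁ ps) ≤ height ps →
    z ∈ combination (reweigh (D ⊓_) ps) → z % D ≡ y % D → y ∈ combination ps
  lift-representative {ps} {y} {z} pts dvs T≤y y+T≤h z∈ z≡y =
    subst (_∈ combination ps) (sym y≡z+qD)
      (combination-split (m⊓n+n∸m≡n D) ps z∈ (multiples-combination (All-map⁺ pts) (All-map⁺ dvs) q qD-bound))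
    where
    T₀ n : ℕ
    T₀ = D * spread (map proj₁ ps)
    n = length (map proj₁ ps)
    capped excess : Weighted
    capped = reweigh (D ⊓_) ps
    excess = reweigh (_∸ D) ps
    capped≤ : height capped ≤ T₀
    capped≤ = height-reweigh≤ (λ e → m⊓n≤m D e) ps
    z≤y : z ≤ y
    z≤y = ≤-trans (combination≤height capped z∈) (≤-trans capped≤ (≤-trans (m≤m+n T₀ (n * D)) T≤y))
    q : ℕ
    q = proj₁ (residue-gap z≤y z≡y)
    y≡z+qD : y ≡ z + q * D
    y≡z+qD = proj₂ (residue-gap z≤y z≡y)
    qD-bound : q * D + length excess * D ≤ height excess
    qD-bound = subst (λ k → q * D + k * D ≤ height excess) (trans (length-map proj₁ ps) (sym (length-map _ ps)))
      (+-cancelˡ-≤ T₀ _ _ (begin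
        T₀ + (q * D + n * D)          ≤⟨ +-monoʳ-≤ T₀ (+-monoˡ-≤ (n * D) qD≤y) ⟩
        T₀ + (y + n * D)              ≡⟨ x∙yz≈y∙xz T₀ y (n * D) ⟩
        y + (T₀ + n * D)              ≤⟨ y+T≤h ⟩
        height ps                     ≡⟨ height-split (m⊓n+n∸m≡n D) ps ⟩
        height capped + height excess ≤⟨ +-monoˡ-≤ (height excess) capped≤ ⟩
        T₀ + height excess            ∎))
      where
      open ≤-Reasoning
      qD≤y : q * D ≤ y
      qD≤y = subst (q * D ≤_) (sym y≡z+qD) (m≤n+m (q * D) z)

  combination-saturated : ∀ {ps y} → Pointed ps → Dividing ps →
    threshold (map proj₁ ps) ≤ y → y + threshold (map proj₁ ps) ≤ height ps →
    y ∈% combination ps → y ∈ combination ps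
  combination-saturated pts dvs T≤y y+T≤h y∈%
    with z′ , z′∈ , z′≡y ← find y∈%
    with z , z∈ , z≡z′ ← find (combination-residues pts z′∈) =
    lift-representative pts dvs T≤y y+T≤h z∈ (trans z≡z′ z′≡y)

  record Periodic (T : ℕ) (X : List ℕ) : Set where
    field
      top       : ℕ
      0∈        : 0 ∈ X
      top∈      : top ∈ X
      bounded   : All (_≤ top) X
      saturated : ∀ n → T ≤ n → n + T ≤ top → n ∈% X → n ∈ X

  combination-periodic : ∀ {ps} → Pointed ps → Dividing ps →
    Periodic (threshold (map proj₁ ps)) (combination ps)
  combination-periodic {ps} pts dvs = record
    { top       = height ps
    ; 0∈        = 0∈combination pts
    ; top∈      = height∈combination pts
    ; bounded   = All.tabulate (combination≤height ps)
    ; saturated = λ n T≤n n+T≤top → combination-saturated pts dvs T≤n n+T≤top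
    }

  decompose : ∀ {E} j {n} → D ≤ E → n ≤ j * D + E → ∃₂ λ i x → i ≤ j × x ≤ E × n ≡ i * D + x
  decompose zero {n} _ n≤E = 0 , n , z≤n , n≤E , refl
  decompose {E} (suc j) {n} D≤E n≤ with n ≤? E
  ... | yes n≤E = 0 , n , z≤n , n≤E , refl
  ... | no  n≰E with i , x , i≤j , x≤E , n∸D≡ ← decompose j D≤E (m≤n+o⇒m∸n≤o n D (subst (n ≤_) (+-assoc D (j * D) E) n≤)) =
    suc i , x , s≤s i≤j , x≤E , (begin
      n                 ≡⟨ m+[n∸m]≡n D≤n ⟨
      D + (n ∸ D)       ≡⟨ cong (λ w → D + w) n∸D≡ ⟩
      D + (i * D + x)   ≡⟨ +-assoc D (i * D) x ⟨
      suc i * D + x     ∎)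
    where
    open ≡-Reasoning
    D≤n : D ≤ n
    D≤n = ≤-trans D≤E (<⇒≤ (≰⇒> n≰E))

  record Split (L : ℕ) : Set where
    field
      periods width : ℕ
      L≡     : L ≡ periods * D + width
      width< : width < D + D
      covers : ∀ {n} → n ≤ L → ∃₂ λ i x → i ≤ periods × x ≤ width × n ≡ i * D + x

  split : ∀ L → Split L
  split L with L <? D
  ... | yes L<D = record
    { periods = 0
    ; width   = L
    ; L≡      = refl
    ; width<  = ≤-trans L<D (m≤m+n D D)
    ; covers  = λ {n} n≤L → 0 , n , z≤n , n≤L , refl
    }
  ... | no  L≮D = record
    { periods = j
    ; width   = E
    ; L≡      = L≡
    ; width<  = +-monoʳ-< D (m%n<n (L ∸ D) D)
    ; covers  = λ n≤L → decompose j (m≤m+n D ((L ∸ D) % D)) (subst (_ ≤_) L≡ n≤L)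
    }
    where
    j E : ℕ
    j = (L ∸ D) / D
    E = D + (L ∸ D) % D
    L≡ : L ≡ j * D + E
    L≡ = begin
      L                        ≡⟨ m+[n∸m]≡n (≮⇒≥ L≮D) ⟨
      D + (L ∸ D)              ≡⟨ cong (λ w → D + w) (m≡m%n+[m/n]*n (L ∸ D) D) ⟩
      D + ((L ∸ D) % D + j * D) ≡⟨ +-assoc D _ (j * D) ⟨
      E + j * D                ≡⟨ +-comm E (j * D) ⟩
      j * D + E                ∎
      where open ≡-Reasoning

  ∈-progression⁻ : ∀ j {u} → u ∈ j ⊠ (0 ∷ D ∷ []) → ∃ λ i → i ≤ j × u ≡ i * D
  ∈-progression⁻ zero (here refl) = 0 , z≤n , refl
  ∈-progression⁻ (suc j) u∈ with a , v , a∈ , v∈ , refl ← ∈-⊞⁻ (0 ∷ D ∷ []) (j ⊠ (0 ∷ D ∷ [])) u∈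
                            with i , i≤j , refl ← ∈-progression⁻ j v∈
                            with a∈
  ... | here refl         = i , m≤n⇒m≤1+n i≤j , refl
  ... | there (here refl) = suc i , s≤s i≤j , refl

  %-absorb : ∀ i x → (i * D + x) % D ≡ x % D
  %-absorb i x = trans (cong (_% D) (+-comm (i * D) x)) ([m+kn]%n≡m%n x i D)

  module Shape {T X} (P : Periodic T X) where
    open Periodic P
    open Split (split top) public using (periods)
    open Split (split top) using (width; L≡; width<; covers)

    residue? : Decidable (λ x → x ≤ width × x ∈% X)
    residue? x = (x ≤? width) ×-dec (x ∈%? X)

    highGap? : Decidable (λ t → top ∸ t ∉ X)
    highGap? t = top ∸ t ∉? X

    residues lowGaps highGaps grid : List ℕ
    residues = filter residue? (upTo (D + D))
    lowGaps  = filter (_∉? X) (upTo T)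
    highGaps = filter highGap? (upTo T)
    grid     = periods ⊠ (0 ∷ D ∷ []) ⊞ residues

    ∈-grid⁻ : ∀ {n} → n ∈ grid → n ≤ top × n ∈% X
    ∈-grid⁻ n∈ with u , x , u∈ , x∈ , refl ← ∈-⊞⁻ (periods ⊠ (0 ∷ D ∷ [])) residues n∈
               with i , i≤ , refl ← ∈-progression⁻ periods u∈
               with _ , x≤ , x∈%X ← ∈-filter⁻ residue? {xs = upTo (D + D)} x∈ =
      subst (i * D + x ≤_) (sym L≡) (+-mono-≤ (*-monoˡ-≤ D i≤) x≤) ,
      Any.map (λ z≡x → trans z≡x (sym (%-absorb i x))) x∈%X

    ∈-grid⁺ : ∀ {n} → n ≤ top → n ∈% X → n ∈ grid
    ∈-grid⁺ n≤top n∈%X with i , x , i≤ , x≤ , refl ← covers n≤top =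
      ∈-⊞⁺ (∈-⊠-mono (here refl) i≤ (*∈⊠ (there (here refl)) i))
        (∈-filter⁺ residue? (∈-upTo⁺ (≤-<-trans x≤ width<))
          (x≤ , Any.map (λ z≡ → trans z≡ (%-absorb i x)) n∈%X))

    highGaps≤ : All (_≤ top) highGaps
    highGaps≤ = All.tabulate below
      where
      -- a gap t > top is impossible, as then top ∸ t = 0 ∈ X
      below : ∀ {t} → t ∈ highGaps → t ≤ top
      below {t} t∈ with t ≤? top
      ... | yes t≤top = t≤top
      ... | no  t≰top = ⊥-elim (proj₂ (∈-filter⁻ highGap? {xs = upTo T} t∈)
                          (subst (_∈ X) (sym (m≤n⇒m∸n≡0 (<⇒≤ (≰⇒> t≰top)))) 0∈))

    ∈-shape⁺ : ∀ {n} → n ∈ X → n ∈ grid × n ∉ lowGaps × n ∉ map (top ∸_) highGaps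
    ∈-shape⁺ {n} n∈X = ∈-grid⁺ (All.lookup bounded n∈X) (∈⇒∈% n∈X) , notLow , notHigh
      where
      notLow : n ∉ lowGaps
      notLow n∈ = proj₂ (∈-filter⁻ (_∉? X) {xs = upTo T} n∈) n∈X
      notHigh : n ∉ map (top ∸_) highGaps
      notHigh n∈ with t , t∈ , refl ← ∈-map⁻ (top ∸_) n∈ =
        proj₂ (∈-filter⁻ highGap? {xs = upTo T} t∈) n∈X

    ∈-shape⁻ : ∀ {n} → n ∈ grid → n ∉ lowGaps → n ∉ map (top ∸_) highGaps → n ∈ X
    ∈-shape⁻ {n} n∈grid notLow notHigh with n ∈? X
    ... | yes n∈X = n∈X
    ... | no  n∉X with n <? T
    ...   | yes n<T = ⊥-elim (notLow (∈-filter⁺ (_∉? X) (∈-upTo⁺ n<T) n∉X))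
    ...   | no  n≮T with n + T ≤? top
    ...     | yes n+T≤top = saturated n (≮⇒≥ n≮T) n+T≤top (proj₂ (∈-grid⁻ n∈grid))
    ...     | no  n+T≰top = ⊥-elim (notHigh (subst (_∈ map (top ∸_) highGaps) (m∸[m∸n]≡n n≤top)
                              (∈-map⁺ (top ∸_) (∈-filter⁺ highGap? (∈-upTo⁺ top∸n<T)
                                (subst (_∉ X) (sym (m∸[m∸n]≡n n≤top)) n∉X)))))
      where
      n≤top : n ≤ top
      n≤top = proj₁ (∈-grid⁻ n∈grid)
      top∸n<T : top ∸ n < T
      top∸n<T = +-cancelʳ-< n (top ∸ n) T
        (subst₂ _<_ (sym (m∸n+n≡m n≤top)) (+-comm n T) (≰⇒> n+T≰top))

    grid≡ : (periods ⊗ (+ 0 ∷ + D ∷ [])) ⊕ toℤ residues ≡ toℤ grid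
    grid≡ = begin
      (periods ⊗ toℤ (0 ∷ D ∷ [])) ⊕ toℤ residues
        ≡⟨ ⊕≡⊞ (periods ⊗ toℤ (0 ∷ D ∷ [])) (toℤ residues) ⟩
      (periods ⊗ toℤ (0 ∷ D ∷ [])) ℤˢ.⊞ toℤ residues
        ≡⟨ cong (ℤˢ._⊞ toℤ residues) (trans (⊗≡⊠ periods _) (sym (toℤ-⊠ periods (0 ∷ D ∷ [])))) ⟩
      toℤ (periods ⊠ (0 ∷ D ∷ [])) ℤˢ.⊞ toℤ residues
        ≡⟨ toℤ-⊞ (periods ⊠ (0 ∷ D ∷ [])) residues ⟨
      toℤ grid
        ∎
      where open ≡-Reasoning

    periodic-shape : toℤ X ≋ (((periods ⊗ (+ 0 ∷ + D ∷ [])) ⊕ toℤ residues) ⊖ toℤ lowGaps) ⊖′ toℤ highGaps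
    periodic-shape rewrite grid≡ =
      ≋-trans (≋-map (+_) X≋survivors)
        (≋-sym (embedded-pruning (∈-grid⁺ z≤n (∈⇒∈% 0∈)) (∈-grid⁺ ≤-refl (∈⇒∈% top∈))
          (All.tabulate (proj₁ ∘ ∈-grid⁻)) (proj₁ (proj₂ (∈-shape⁺ top∈))) highGaps≤))
      where
      survives : Decidable (λ n → n ∉ lowGaps × n ∉ map (top ∸_) highGaps)
      survives n = (n ∉? lowGaps) ×-dec (n ∉? map (top ∸_) highGaps)
      X≋survivors : X ≋ filter survives grid
      X≋survivors = mk≋
        (λ n∈X → let g , l , h = ∈-shape⁺ n∈X in ∈-filter⁺ survives g (l , h))
        (λ n∈ → let g , l , h = ∈-filter⁻ survives {xs = grid} n∈ in ∈-shape⁻ g l h)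

-- The finite list of types

sublists : List A → List (List A)
sublists []       = [] ∷ []
sublists (x ∷ xs) = map (x ∷_) (sublists xs) ++ sublists xs

filter∈sublists : {P : A → Set} (P? : Decidable P) → ∀ xs → filter P? xs ∈ sublists xs
filter∈sublists P? []       = here refl
filter∈sublists P? (x ∷ xs) with P? x
... | yes _ = ∈-++⁺ˡ (∈-map⁺ (x ∷_) (filter∈sublists P? xs))
... | no  _ = ∈-++⁺ʳ (map (x ∷_) (sublists xs)) (filter∈sublists P? xs)

emptyOrPointed : ∀ ss → [] ∈ map normalize ss ⊎ All (λ s → 0 ∈ normalize s) ss
emptyOrPointed []              = inj₂ []
emptyOrPointed ([] ∷ ss)       = inj₁ (here refl)
emptyOrPointed ((x ∷ xs) ∷ ss) with emptyOrPointed ss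
... | inj₁ []∈ = inj₁ (there []∈)
... | inj₂ pts = inj₂ (0∈normalize x xs ∷ pts)

module Catalogue (S : List FinSet) where

  S₀ : List (List ℕ)
  S₀ = filter (0 ∈?_) (map normalize S)

  D : ℕ
  D = product (map (λ s → max 0 s ⊔ 1) S₀)

  instance
    D≢0 : NonZero D
    D≢0 = product≢0 (All-map⁺ {xs = S₀} {f = λ s → max 0 s ⊔ 1} (All.tabulate λ {s} _ → >-nonZero (m≤n⊔m (max 0 s) 1)))

  open Modulo D

  T : ℕ
  T = threshold S₀

  -- mkType 0 0 [] [] [] describes only the empty set.
  types : List TypeParams
  types = mkType 0 0 [] [] [] ∷
    cartesianProductWith (λ a bc → mkType D 0 (toℤ a) (toℤ (proj₁ bc)) (toℤ (proj₂ bc)))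
      (sublists (upTo T)) (cartesianProduct (sublists (upTo (D + D))) (sublists (upTo T)))

  S₀-pointed : All (0 ∈_) S₀
  S₀-pointed = All.tabulate λ s∈ → proj₂ (∈-filter⁻ (0 ∈?_) {xs = map normalize S} s∈)

  S₀-dividing : All (λ s → max 0 s ≡ 0 ⊎ max 0 s ∣ D) S₀
  S₀-dividing = All.tabulate dividing
    where
    dividing : ∀ {s} → s ∈ S₀ → max 0 s ≡ 0 ⊎ max 0 s ∣ D
    dividing {s} s∈ with max 0 s in max≡
    ... | zero  = inj₁ refl
    ... | suc d = inj₂ (subst (_∣ D) (trans (cong (_⊔ 1) max≡) (cong suc (⊔-identityʳ d))) (∈⇒∣product (∈-map⁺ (λ s → max 0 s ⊔ 1) s∈)))

  ∈types : ∀ {a b c} → a ∈ sublists (upTo T) → b ∈ sublists (upTo (D + D)) → c ∈ sublists (upTo T) →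
    mkType D 0 (toℤ a) (toℤ b) (toℤ c) ∈ types
  ∈types a∈ b∈ c∈ = there (∈-cartesianProductWith⁺ _ a∈ (∈-cartesianProduct⁺ b∈ c∈))

  normalize∈S₀ : ∀ {s} → s ∈ S × 0 ∈ normalize s → normalize s ∈ S₀
  normalize∈S₀ (s∈ , 0∈) = ∈-filter⁺ (0 ∈?_) (∈-map⁺ normalize s∈) 0∈

  empty-sum : ∀ ss → [] ∈ map normalize ss → Any (InType (sumOf ss)) types
  empty-sum ss []∈ = here (+ 0 , 0 , z≤n , subst (_≋ []) (sym sumOf≡[]) ≋-refl)
    where
    sumOf≡[] : sumOf ss ≡ []
    sumOf≡[] = trans (sumOf-embedAt ss) (cong (embedAt (offset ss)) (⨁-zero []∈))

  pointed-sum : ∀ ss → All (_∈ S) ss → All (λ s → 0 ∈ normalize s) ss → Any (InType (sumOf ss)) types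
  pointed-sum ss ss⊆S pointed
    with ps , sets≡ , ⨁≋ ← ⨁≋combination S₀ (map normalize ss) (All-map⁺ (All.zipWith normalize∈S₀ (ss⊆S , pointed))) =
    lose (∈types (filter∈sublists _ (upTo T)) (filter∈sublists _ (upTo (D + D))) (filter∈sublists _ (upTo T)))
      (offset ss , periods , z≤n , sumOf≋)
    where
    periodic : Periodic T (combination ps)
    periodic = subst (λ S′ → Periodic (threshold S′) (combination ps)) sets≡
      (combination-periodic (All-map⁻ (subst (All (0 ∈_)) (sym sets≡) S₀-pointed))
                            (All-map⁻ (subst (All _) (sym sets≡) S₀-dividing)))
    open Shape periodic
    typeSet : FinSet
    typeSet = (((periods ⊗ (+ 0 ∷ + D ∷ [])) ⊕ toℤ residues) ⊖ toℤ lowGaps) ⊖′ toℤ highGaps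
    sumOf≋ : sumOf ss ≋ shift typeSet (offset ss)
    sumOf≋ = subst (_≋ shift typeSet (offset ss))
      (sym (trans (sumOf-embedAt ss) (embedAt≡shift (offset ss) (⨁ (map normalize ss)))))
      (≋-map (λ x → x ℤ.+ offset ss) (≋-trans (≋-map (+_) ⨁≋) periodic-shape))

proposition4p2 : (S : List FinSet) →
    ∃ λ (types : List TypeParams) →
      (ss : List FinSet) → All (λ s → s ∈ S) ss →
        Any (λ T → InType (sumOf ss) T) types
proposition4p2 S = types , λ ss ss⊆S → [ empty-sum ss , pointed-sum ss ss⊆S ]′ (emptyOrPointed ss)
  where open Catalogue S
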